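{- The lower chordal switching class, the lower strongly chordal switching class, the lower interval switching class, the lower proper interval switching class, and the lower Ptolemaic switching class are all equal to the lower $\{C_4,C_5,C_6\}$-free switching class.
   Context: All graphs are finite and simple. For a graph $G$ and $A\subseteq V(G)$, the switching $S(G,A)$ is the graph on $V(G)$ whose edges are the edges of $G$ with both ends in $A$, the edges of $G$ with both ends outside $A$, and all pairs $uv$ with $u\in A$, $v\notin A$, $uv\notin E(G)$. For a graph class $\mathcal{G}$, the lower $\mathcal{G}$ switching class is the class of graphs $G$ such that $S(G,A)\in\mathcal{G}$ for every $A\subseteq V(G)$. The $\{C_4,C_5,C_6\}$-free graphs are those with no induced cycle of length 4, 5 or 6. A graph is chordal if it has no induced cycle of length at least four; strongly chordal if it is chordal and every even cycle of length at least six has an odd chord; interval if it is the intersection graph of a family of intervals on the real line; proper interval if it is the intersection graph of a family of intervals none properly containing another; Ptolemaic if it is chordal and contains no induced gem, where the gem is a path on four vertices plus a vertex adjacent to all four.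
   Formalization: The intervals representing interval and proper interval graphs have rational endpoints rather than endpoints on the real line. -}

module Defs where

open import Data.Nat using (ℕ; zero; suc; _+_; _≤_; _%_)
open import Data.Fin using (Fin; toℕ)
open import Data.Bool using (Bool; true; false; not; if_then_else_)
open import Data.Bool.Properties using () renaming (_≟_ to _≟ᵇ_)
open import Data.Product using (Σ; _×_; _,_; ∃)
open import Data.Sum using (_⊎_)
open import Data.Empty using (⊥; ⊥-elim)
open import Relation.Nullary using (¬_; does; yes; no)
open import Relation.Binary.PropositionalEquality using (_≡_; refl; sym; cong)
open import Function.Definitions using (Injective)
open import Data.Rational using (ℚ) renaming (_≤_ to _≤ℚ_; _<_ to _<ℚ_)

record Graph (n : ℕ) : Set where
  field
    adj    : Fin n → Fin n → Bool
    adj-sym    : ∀ u v → adj u v ≡ adj v u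
    adj-irrefl : ∀ u → adj u u ≡ false
open Graph public

Adj : ∀ {n} → Graph n → Fin n → Fin n → Set
Adj G u v = adj G u v ≡ true

VSubset : ℕ → Set
VSubset n = Fin n → Bool

switchAdj : ∀ {n} → Graph n → VSubset n → Fin n → Fin n → Bool
switchAdj G A u v = if does (A u ≟ᵇ A v) then adj G u v else not (adj G u v)

private

  switch-sym : ∀ {n} (G : Graph n) (A : VSubset n) u v →
               switchAdj G A u v ≡ switchAdj G A v u
  switch-sym G A u v with A u ≟ᵇ A v | A v ≟ᵇ A u
  ... | yes _ | yes _ = adj-sym G u v
  ... | yes p | no ¬q = ⊥-elim (¬q (sym p))
  ... | no ¬p | yes q = ⊥-elim (¬p (sym q))
  ... | no _ | no _ = cong not (adj-sym G u v)

  switch-irrefl : ∀ {n} (G : Graph n) (A : VSubset n) u →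
                  switchAdj G A u u ≡ false
  switch-irrefl G A u with A u ≟ᵇ A u
  ... | yes _ = adj-irrefl G u
  ... | no ¬p = ⊥-elim (¬p refl)

S : ∀ {n} → Graph n → VSubset n → Graph n
S G A = record
  { adj        = switchAdj G A
  ; adj-sym    = switch-sym G A
  ; adj-irrefl = switch-irrefl G A
  }

GraphClass : Set₁
GraphClass = ∀ {n} → Graph n → Set

Lower : GraphClass → GraphClass
Lower 𝒢 {n} G = (A : VSubset n) → 𝒢 (S G A)

_≐_ : GraphClass → GraphClass → Set
𝒢 ≐ ℋ = ∀ {n} (G : Graph n) → (𝒢 G → ℋ G) × (ℋ G → 𝒢 G)

CycAdj : (k : ℕ) → Fin k → Fin k → Set
CycAdj k i j =
  (suc (toℕ i) ≡ toℕ j) ⊎ (suc (toℕ j) ≡ toℕ i) ⊎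
  ((toℕ i ≡ 0 × suc (toℕ j) ≡ k) ⊎ (toℕ j ≡ 0 × suc (toℕ i) ≡ k))

InducedCycle : ∀ {n} → Graph n → ℕ → Set
InducedCycle {n} G k =
  3 ≤ k × Σ (Fin k → Fin n) λ f → Injective _≡_ _≡_ f ×
    (∀ i j → (Adj G (f i) (f j) → CycAdj k i j) × (CycAdj k i j → Adj G (f i) (f j)))

CycleIn : ∀ {n} → Graph n → (k : ℕ) → (Fin k → Fin n) → Set
CycleIn G k f = 3 ≤ k × Injective _≡_ _≡_ f × (∀ i j → CycAdj k i j → Adj G (f i) (f j))

-- An odd chord of the cycle f: an edge between two non-consecutive cycle
-- vertices whose distance along the cycle is odd.
HasOddChord : ∀ {n} → Graph n → (k : ℕ) → (Fin k → Fin n) → Set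
HasOddChord G k f = ∃ λ i → ∃ λ j →
  Adj G (f i) (f j) × ¬ CycAdj k i j × (toℕ i + toℕ j) % 2 ≡ 1

C456Free : GraphClass
C456Free G = ¬ InducedCycle G 4 × ¬ InducedCycle G 5 × ¬ InducedCycle G 6

Chordal : GraphClass
Chordal G = ∀ k → 4 ≤ k → ¬ InducedCycle G k

StronglyChordal : GraphClass
StronglyChordal {n} G = Chordal G ×
  (∀ k → 6 ≤ k → k % 2 ≡ 0 → (f : Fin k → Fin n) → CycleIn G k f → HasOddChord G k f)

record Interval : Set where
  constructor [_,_]⟨_⟩
  field
    l r : ℚ
    l≤r : l ≤ℚ r
open Interval public

Intersect : Interval → Interval → Set
Intersect I J = (l I ≤ℚ r J) × (l J ≤ℚ r I)

ProperlyContained : Interval → Interval → Set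
ProperlyContained I J = (l J ≤ℚ l I) × (r I ≤ℚ r J) × ((l J <ℚ l I) ⊎ (r I <ℚ r J))

IsIntervalModel : ∀ {n} → Graph n → (Fin n → Interval) → Set
IsIntervalModel G ι = ∀ u v → ¬ u ≡ v →
  (Adj G u v → Intersect (ι u) (ι v)) × (Intersect (ι u) (ι v) → Adj G u v)

Interval-graph : GraphClass
Interval-graph {n} G = Σ (Fin n → Interval) λ ι → IsIntervalModel G ι

ProperInterval : GraphClass
ProperInterval {n} G = Σ (Fin n → Interval) λ ι → IsIntervalModel G ι ×
  (∀ u v → ¬ ProperlyContained (ι u) (ι v))

-- The gem: the path 0-1-2-3 plus vertex 4 adjacent to all of 0,1,2,3.
GemAdj : Fin 5 → Fin 5 → Set
GemAdj i j =
  (suc (toℕ i) ≡ toℕ j × toℕ j ≤ 3) ⊎ (suc (toℕ j) ≡ toℕ i × toℕ i ≤ 3) ⊎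
  ((toℕ i ≡ 4 × toℕ j ≤ 3) ⊎ (toℕ j ≡ 4 × toℕ i ≤ 3))

InducedGem : ∀ {n} → Graph n → Set
InducedGem {n} G = Σ (Fin 5 → Fin n) λ f → Injective _≡_ _≡_ f ×
  (∀ i j → (Adj G (f i) (f j) → GemAdj i j) × (GemAdj i j → Adj G (f i) (f j)))

Ptolemaic : GraphClass
Ptolemaic G = Chordal G × ¬ InducedGem G

-- Switching at the neighbourhood of a vertex v isolates v.  If every switch of the result is
-- C4- and C5-free, then the vertices other than v contain no independent triple, no induced C4
-- and no induced P4, since a suitable switch turns each of them, together with v, into an induced
-- C4 or C5.  Hence the centre of every induced P3 avoiding v is adjacent to all vertices but v,
-- and the vertices without this property form at most two cliques with no edges between them:
-- G is a switch of a disjoint union of three cliques, and so is every switch of G.  Labelling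
-- each vertex by its clique and its side of the switch, two vertices are adjacent iff their
-- labels are equal or consecutive around a hexagon.  In a C6-free switch some label is missing,
-- and the hexagon minus a vertex is a path, so the switch is a blow-up of a path: it is proper
-- interval, strongly chordal and Ptolemaic.  Conversely, graphs in each of the five classes are
-- chordal, hence C4-, C5- and C6-free.

{-# OPTIONS --safe #-}
module Submission where

open import Defs

open import Algebra.Bundles using (CommutativeRing)
import Algebra.Properties.CommutativeSemigroup as CommutativeSemigroupProperties
open import Data.Bool using (Bool; true; false; _xor_; _∧_; _∨_; if_then_else_)
open import Data.Bool.Properties
  using (xor-assoc; xor-same; xor-identityʳ; xor-comm; xor-∧-commutativeRing; ¬-not; not-¬)
  renaming (_≟_ to _≟ᵇ_)
open import Data.Empty using (⊥; ⊥-elim)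
open import Data.Fin using (Fin; zero; suc; toℕ; fromℕ; inject₁; lower₁; opposite; #_)
  renaming (_≤_ to _≤ᶠ_)
open import Data.Fin.Properties as FinP
  using (any?; all?; ¬∀⟶∃¬; toℕ-injective; toℕ-fromℕ; toℕ-inject₁; toℕ-lower₁; toℕ<n)
open import Data.Integer using (+_)
open import Data.List using (allFin)
import Data.List.Extrema as Extrema
import Data.List.Relation.Unary.All as All
open import Data.List.Relation.Unary.All using ([]; _∷_)
open import Data.List.Relation.Unary.AllPairs using (AllPairs; []; _∷_)
open import Data.List.Membership.Propositional.Properties using (∈-allFin; ∈-AllPairs₂)
open import Data.Nat as ℕ using (ℕ; zero; suc; _+_; _≤_; _<_; _%_; s≤s; parity)
import Data.Nat.Properties as ℕP
open import Data.Parity as ℙ using (0ℙ; 1ℙ)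
import Data.Parity.Properties as ℙP
open import Data.Product using (Σ; _×_; _,_; proj₁; proj₂; ∃; ∃₂; uncurry)
open import Data.Rational using (ℚ; _/_) renaming (_≤_ to _≤ℚ_)
import Data.Rational.Properties as ℚP
open import Data.Sum using (_⊎_; inj₁; inj₂; [_,_]′)
open import Data.Vec using (Vec; []; _∷_; lookup)
open import Function using (_∘_; id)
open import Function.Bundles using (mk⇔)
open import Function.Definitions using (Injective)
open import Relation.Binary.Bundles using (TotalOrder; DecTotalOrder)
open import Relation.Binary.PropositionalEquality
  using (_≡_; _≢_; refl; sym; trans; cong; cong₂; subst; ≢-sym; module ≡-Reasoning)
open import Relation.Nullary using (¬_; Dec; yes; no; does)
open import Relation.Nullary.Decidable
  using (from-yes; map′; dec-true; dec-false; does-⇔; _×-dec_; _⊎-dec_; _→-dec_; ¬?)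

open CommutativeSemigroupProperties (CommutativeRing.+-commutativeSemigroup xor-∧-commutativeRing)
  using () renaming (interchange to xor-interchange)
open CommutativeSemigroupProperties ℙP.+-commutativeSemigroup
  using () renaming (interchange to +-interchange)

private
  variable
    n k : ℕ

-- Switching

xor-cancelʳ : ∀ x y → (x xor y) xor y ≡ x
xor-cancelʳ x y = begin
  (x xor y) xor y   ≡⟨ xor-assoc x y y ⟩
  x xor (y xor y)   ≡⟨ cong (x xor_) (xor-same y) ⟩
  x xor false       ≡⟨ xor-identityʳ x ⟩
  x                 ∎
  where open ≡-Reasoning

xor-regroup : ∀ x s t a b → (x xor (s xor t)) xor (a xor b) ≡ x xor ((s xor a) xor (t xor b))
xor-regroup x s t a b = trans (xor-assoc x _ _) (cong (x xor_) (xor-interchange s t a b))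

infix 4 _≈ᴳ_
record _≈ᴳ_ (G H : Graph n) : Set where
  constructor same-adj
  field adj-≡ : ∀ u w → adj G u w ≡ adj H u w
open _≈ᴳ_

Respects≈ : GraphClass → Set
Respects≈ 𝒢 = ∀ {n} {G H : Graph n} → G ≈ᴳ H → 𝒢 G → 𝒢 H

_⊕_ : VSubset n → VSubset n → VSubset n
(A ⊕ B) u = A u xor B u

switch-adj : ∀ (G : Graph n) A u w → adj (S G A) u w ≡ adj G u w xor (A u xor A w)
switch-adj G A u w with A u | A w
... | true  | true  = sym (xor-identityʳ _)
... | true  | false = sym (xor-comm _ true)
... | false | true  = sym (xor-comm _ true)
... | false | false = sym (xor-identityʳ _)

switch-switch : ∀ (G : Graph n) A B → S (S G A) B ≈ᴳ S G (A ⊕ B)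
switch-switch G A B = same-adj λ u w → begin
  adj (S (S G A) B) u w                            ≡⟨ switch-adj (S G A) B u w ⟩
  adj (S G A) u w xor (B u xor B w)                ≡⟨ cong (_xor (B u xor B w)) (switch-adj G A u w) ⟩
  (adj G u w xor (A u xor A w)) xor (B u xor B w)  ≡⟨ xor-regroup (adj G u w) (A u) (A w) (B u) (B w) ⟩
  adj G u w xor ((A ⊕ B) u xor (A ⊕ B) w)          ≡⟨ switch-adj G (A ⊕ B) u w ⟨
  adj (S G (A ⊕ B)) u w                            ∎
  where open ≡-Reasoning

switch-involutive : ∀ (G : Graph n) A → S (S G A) A ≈ᴳ G
switch-involutive G A = same-adj λ u w → begin
  adj (S (S G A) A) u w                            ≡⟨ switch-adj (S G A) A u w ⟩
  adj (S G A) u w xor (A u xor A w)                ≡⟨ cong (_xor (A u xor A w)) (switch-adj G A u w) ⟩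
  (adj G u w xor (A u xor A w)) xor (A u xor A w)  ≡⟨ xor-cancelʳ (adj G u w) (A u xor A w) ⟩
  adj G u w                                        ∎
  where open ≡-Reasoning

≈ᴳ-sym : {G H : Graph n} → G ≈ᴳ H → H ≈ᴳ G
≈ᴳ-sym G≈H = same-adj λ u w → sym (adj-≡ G≈H u w)

lower-switch : {𝒢 : GraphClass} → Respects≈ 𝒢 → {G : Graph n} → Lower 𝒢 G → ∀ A → Lower 𝒢 (S G A)
lower-switch resp {G} lower A B = resp (≈ᴳ-sym (switch-switch G A B)) (lower (A ⊕ B))

switch-isolates : ∀ (G : Graph n) v w → adj (S G (adj G v)) v w ≡ false
switch-isolates G v w = begin
  adj (S G (adj G v)) v w                  ≡⟨ switch-adj G (adj G v) v w ⟩
  adj G v w xor (adj G v v xor adj G v w)  ≡⟨ cong (λ b → adj G v w xor (b xor adj G v w)) (adj-irrefl G v) ⟩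
  adj G v w xor adj G v w                  ≡⟨ xor-same (adj G v w) ⟩
  false                                    ∎
  where open ≡-Reasoning

inducedCycle-resp : ∀ k → Respects≈ (λ G → InducedCycle G k)
inducedCycle-resp k G≈H (3≤k , f , f-inj , f-cycle) =
  3≤k , f , f-inj , λ i j → (λ e → proj₁ (f-cycle i j) (trans (adj-≡ G≈H _ _) e))
                          , (λ c → trans (sym (adj-≡ G≈H _ _)) (proj₂ (f-cycle i j) c))

c456Free-resp : Respects≈ C456Free
c456Free-resp G≈H (no4 , no5 , no6) =
  no4 ∘ inducedCycle-resp 4 H≈G , no5 ∘ inducedCycle-resp 5 H≈G , no6 ∘ inducedCycle-resp 6 H≈G
  where H≈G = ≈ᴳ-sym G≈H

-- Cycle indices

cycAdj? : ∀ k (i j : Fin k) → Dec (CycAdj k i j)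
cycAdj? k i j =
  (suc (toℕ i) ℕ.≟ toℕ j) ⊎-dec (suc (toℕ j) ℕ.≟ toℕ i) ⊎-dec
  ((toℕ i ℕ.≟ 0) ×-dec (suc (toℕ j) ℕ.≟ k)) ⊎-dec ((toℕ j ℕ.≟ 0) ×-dec (suc (toℕ i) ℕ.≟ k))

cycAdj-sym : {i j : Fin k} → CycAdj k i j → CycAdj k j i
cycAdj-sym (inj₁ e)                = inj₂ (inj₁ e)
cycAdj-sym (inj₂ (inj₁ e))         = inj₁ e
cycAdj-sym (inj₂ (inj₂ (inj₁ e)))  = inj₂ (inj₂ (inj₂ e))
cycAdj-sym (inj₂ (inj₂ (inj₂ e)))  = inj₂ (inj₂ (inj₁ e))

cycAdj-irrefl : 2 ≤ k → (i : Fin k) → ¬ CycAdj k i i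
cycAdj-irrefl _ i (inj₁ i+1≡i)        = ℕP.1+n≢n i+1≡i
cycAdj-irrefl _ i (inj₂ (inj₁ i+1≡i)) = ℕP.1+n≢n i+1≡i
cycAdj-irrefl (s≤s (s≤s _)) i (inj₂ (inj₂ (inj₁ (i≡0 , i+1≡k))))
  with () ← trans (cong suc (sym i≡0)) i+1≡k
cycAdj-irrefl (s≤s (s≤s _)) i (inj₂ (inj₂ (inj₂ (i≡0 , i+1≡k))))
  with () ← trans (cong suc (sym i≡0)) i+1≡k

cycAdj⇒≢ : 2 ≤ k → {i j : Fin k} → CycAdj k i j → i ≢ j
cycAdj⇒≢ 2≤k {i} i~j refl = cycAdj-irrefl 2≤k i i~j

next : Fin k → Fin k
next {suc k} i with toℕ i ℕ.≟ k
... | yes _   = zero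
... | no i≢k = suc (lower₁ i (i≢k ∘ sym))

toℕ-next : (i : Fin k) →
  (suc (toℕ i) ≡ k × toℕ (next i) ≡ 0) ⊎ (suc (toℕ i) ≢ k × toℕ (next i) ≡ suc (toℕ i))
toℕ-next {suc k} i with toℕ i ℕ.≟ k
... | yes i≡k = inj₁ (cong suc i≡k , refl)
... | no i≢k = inj₂ (i≢k ∘ ℕP.suc-injective , cong suc (toℕ-lower₁ i _))

next-cycAdj : (i : Fin k) → CycAdj k i (next i)
next-cycAdj i with toℕ-next i
... | inj₁ (i+1≡k , next≡0) = inj₂ (inj₂ (inj₂ (next≡0 , i+1≡k)))
... | inj₂ (_ , next≡i+1)   = inj₁ (sym next≡i+1)

private
  successor⇒next : {i j : Fin k} → suc (toℕ i) ≡ toℕ j → next i ≡ j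
  successor⇒next {i = i} {j} i+1≡j with toℕ-next i
  ... | inj₁ (i+1≡k , _)    = ⊥-elim (ℕP.<-irrefl (trans (sym i+1≡j) i+1≡k) (toℕ<n j))
  ... | inj₂ (_ , next≡i+1) = toℕ-injective (trans next≡i+1 i+1≡j)

  wrap⇒next : {i j : Fin k} → suc (toℕ i) ≡ k → toℕ j ≡ 0 → next i ≡ j
  wrap⇒next {i = i} i+1≡k j≡0 with toℕ-next i
  ... | inj₁ (_ , next≡0) = toℕ-injective (trans next≡0 (sym j≡0))
  ... | inj₂ (i+1≢k , _)  = ⊥-elim (i+1≢k i+1≡k)

cycAdj⇒next : {i j : Fin k} → CycAdj k i j → next i ≡ j ⊎ next j ≡ i
cycAdj⇒next (inj₁ i+1≡j)                         = inj₁ (successor⇒next i+1≡j)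
cycAdj⇒next (inj₂ (inj₁ j+1≡i))                  = inj₂ (successor⇒next j+1≡i)
cycAdj⇒next (inj₂ (inj₂ (inj₁ (i≡0 , j+1≡k))))  = inj₂ (wrap⇒next j+1≡k i≡0)
cycAdj⇒next (inj₂ (inj₂ (inj₂ (j≡0 , i+1≡k))))  = inj₁ (wrap⇒next i+1≡k j≡0)

next-injective : {i j : Fin k} → next i ≡ next j → i ≡ j
next-injective {i = i} {j} e with toℕ-next i | toℕ-next j
... | inj₁ (i+1≡k , _)  | inj₁ (j+1≡k , _) = toℕ-injective (ℕP.suc-injective (trans i+1≡k (sym j+1≡k)))
... | inj₁ (_ , i′≡0)   | inj₂ (_ , j′≡j+1) = ⊥-elim (ℕP.0≢1+n (trans (sym i′≡0) (trans e′ j′≡j+1)))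
  where e′ = cong toℕ e
... | inj₂ (_ , i′≡i+1) | inj₁ (_ , j′≡0)   = ⊥-elim (ℕP.0≢1+n (trans (sym j′≡0) (trans e′ i′≡i+1)))
  where e′ = cong toℕ (sym e)
... | inj₂ (_ , i′≡i+1) | inj₂ (_ , j′≡j+1) =
  toℕ-injective (ℕP.suc-injective (trans (sym i′≡i+1) (trans (cong toℕ e) j′≡j+1)))

next-preserves-cycAdj : {i j : Fin k} → CycAdj k i j → CycAdj k (next i) (next j)
next-preserves-cycAdj c with cycAdj⇒next c
... | inj₁ refl = next-cycAdj (next _)
... | inj₂ refl = cycAdj-sym (next-cycAdj (next _))

next-reflects-cycAdj : {i j : Fin k} → CycAdj k (next i) (next j) → CycAdj k i j
next-reflects-cycAdj {i = i} {j} c with cycAdj⇒next c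
... | inj₁ e = subst (CycAdj _ i) (next-injective e) (next-cycAdj i)
... | inj₂ e = cycAdj-sym (subst (CycAdj _ j) (next-injective e) (next-cycAdj j))

rotate : ℕ → Fin k → Fin k
rotate zero    i = i
rotate (suc m) i = next (rotate m i)

rotate-preserves-cycAdj : ∀ m {i j : Fin k} → CycAdj k i j → CycAdj k (rotate m i) (rotate m j)
rotate-preserves-cycAdj zero    c = c
rotate-preserves-cycAdj (suc m) c = next-preserves-cycAdj (rotate-preserves-cycAdj m c)

rotate-reflects-cycAdj : ∀ m {i j : Fin k} → CycAdj k (rotate m i) (rotate m j) → CycAdj k i j
rotate-reflects-cycAdj zero    c = c
rotate-reflects-cycAdj (suc m) c = rotate-reflects-cycAdj m (next-reflects-cycAdj c)

rotate-injective : ∀ m {i j : Fin k} → rotate m i ≡ rotate m j → i ≡ j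
rotate-injective zero    e = e
rotate-injective (suc m) e = rotate-injective m (next-injective e)

toℕ-rotate-zero : ∀ m → m < suc k → toℕ (rotate m (zero {k})) ≡ m
toℕ-rotate-zero zero    _   = refl
toℕ-rotate-zero (suc m) m<k with toℕ-next (rotate m zero) | toℕ-rotate-zero m (ℕP.<⇒≤ m<k)
... | inj₁ (r+1≡k , _)   | r≡m = ⊥-elim (ℕP.<-irrefl (trans (cong suc (sym r≡m)) r+1≡k) m<k)
... | inj₂ (_ , r′≡r+1) | r≡m = trans r′≡r+1 (cong suc r≡m)

rotate-zero : (i : Fin (suc k)) → rotate (toℕ i) zero ≡ i
rotate-zero i = toℕ-injective (toℕ-rotate-zero (toℕ i) (toℕ<n i))

rotate-from-zero : (i : Fin (suc k)) {j : Fin (suc k)} →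
  CycAdj (suc k) zero j → CycAdj (suc k) i (rotate (toℕ i) j)
rotate-from-zero i {j} c =
  subst (λ x → CycAdj _ x (rotate (toℕ i) j)) (rotate-zero i) (rotate-preserves-cycAdj (toℕ i) c)

neighbours : 4 ≤ k → (i : Fin k) → ∃₂ λ a b → CycAdj k i a × CycAdj k i b × a ≢ b × ¬ CycAdj k a b
neighbours {suc (suc (suc (suc k)))} (s≤s (s≤s (s≤s (s≤s _)))) i =
  rotate t one , rotate t last , rotate-from-zero i (inj₁ refl) , rotate-from-zero i zero~last ,
  one≢last ∘ rotate-injective t , one≁last ∘ rotate-reflects-cycAdj t
  where
  t = toℕ i
  -- the two neighbours of 0, rotated to i
  one last : Fin (4 + k)
  one  = suc zero
  last = fromℕ (3 + k)
  zero~last : CycAdj (4 + k) zero last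
  zero~last = inj₂ (inj₂ (inj₁ (refl , cong suc (toℕ-fromℕ (3 + k)))))
  one≢last : one ≢ last
  one≢last e with () ← trans (cong toℕ e) (toℕ-fromℕ (3 + k))
  one≁last : ¬ CycAdj (4 + k) one last
  one≁last rewrite toℕ-fromℕ (3 + k) = λ
    { (inj₁ ()) ; (inj₂ (inj₁ ())) ; (inj₂ (inj₂ (inj₁ (() , _)))) ; (inj₂ (inj₂ (inj₂ (() , _)))) }

parity-suc : ∀ m → parity (suc m) ≡ 1ℙ ℙ.+ parity m
parity-suc = ℙP.+-homo-+ 1

parity-next : parity k ≡ 0ℙ → (i : Fin k) → parity (toℕ (next i)) ≡ parity (suc (toℕ i))
parity-next k-even i with toℕ-next i
... | inj₁ (i+1≡k , next≡0) = trans (cong parity next≡0) (sym (trans (cong parity i+1≡k) k-even))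
... | inj₂ (_ , next≡i+1)   = cong parity next≡i+1

parity-rotate : parity k ≡ 0ℙ → ∀ m (i : Fin k) → parity (toℕ (rotate m i)) ≡ parity (m + toℕ i)
parity-rotate k-even zero    i = refl
parity-rotate k-even (suc m) i = begin
  parity (toℕ (next (rotate m i)))  ≡⟨ parity-next k-even (rotate m i) ⟩
  parity (suc (toℕ (rotate m i)))   ≡⟨ parity-suc (toℕ (rotate m i)) ⟩
  1ℙ ℙ.+ parity (toℕ (rotate m i))  ≡⟨ cong (1ℙ ℙ.+_) (parity-rotate k-even m i) ⟩
  1ℙ ℙ.+ parity (m + toℕ i)         ≡⟨ parity-suc (m + toℕ i) ⟨
  parity (suc m + toℕ i)            ∎
  where open ≡-Reasoning

parity-rotate-sum : parity k ≡ 0ℙ → ∀ m (i j : Fin k) →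
  parity (toℕ (rotate m i) + toℕ (rotate m j)) ≡ parity (toℕ i + toℕ j)
parity-rotate-sum k-even m i j = begin
  parity (toℕ (rotate m i) + toℕ (rotate m j))
    ≡⟨ ℙP.+-homo-+ (toℕ (rotate m i)) _ ⟩
  parity (toℕ (rotate m i)) ℙ.+ parity (toℕ (rotate m j))
    ≡⟨ cong₂ ℙ._+_ (parity-rotate k-even m i) (parity-rotate k-even m j) ⟩
  parity (m + toℕ i) ℙ.+ parity (m + toℕ j)
    ≡⟨ cong₂ ℙ._+_ (ℙP.+-homo-+ m (toℕ i)) (ℙP.+-homo-+ m (toℕ j)) ⟩
  (parity m ℙ.+ parity (toℕ i)) ℙ.+ (parity m ℙ.+ parity (toℕ j))
    ≡⟨ +-interchange (parity m) _ _ _ ⟩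
  (parity m ℙ.+ parity m) ℙ.+ (parity (toℕ i) ℙ.+ parity (toℕ j))
    ≡⟨ cong (ℙ._+ _) (proj₁ ℙP.+-inverse (parity m)) ⟩
  parity (toℕ i) ℙ.+ parity (toℕ j)
    ≡⟨ ℙP.+-homo-+ (toℕ i) (toℕ j) ⟨
  parity (toℕ i + toℕ j)
    ∎
  where open ≡-Reasoning

parity≡1ℙ⇒%2≡1 : ∀ m → parity m ≡ 1ℙ → m % 2 ≡ 1
parity≡1ℙ⇒%2≡1 1             _   = refl
parity≡1ℙ⇒%2≡1 (suc (suc m)) odd = parity≡1ℙ⇒%2≡1 m odd

%2≡0⇒parity≡0ℙ : ∀ m → m % 2 ≡ 0 → parity m ≡ 0ℙ
%2≡0⇒parity≡0ℙ zero          _    = refl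
%2≡0⇒parity≡0ℙ (suc (suc m)) even = %2≡0⇒parity≡0ℙ m even

OddChordPair : ∀ k → Fin k → Fin k → Set
OddChordPair k x y = x ≢ y × ¬ CycAdj k x y × parity (toℕ x + toℕ y) ≡ 1ℙ

rotate-oddChordPair : parity k ≡ 0ℙ → ∀ m {x y : Fin k} →
  OddChordPair k x y → OddChordPair k (rotate m x) (rotate m y)
rotate-oddChordPair k-even m {x} {y} (x≢y , x≁y , odd) =
  x≢y ∘ rotate-injective m , x≁y ∘ rotate-reflects-cycAdj m , trans (parity-rotate-sum k-even m x y) odd

record Window (k : ℕ) (i : Fin k) : Set where
  field
    a b c d : Fin k
    a~b : CycAdj k a b
    b~i : CycAdj k b i
    i~c : CycAdj k i c
    c~d : CycAdj k c d
    b-d : OddChordPair k b d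
    c-a : OddChordPair k c a

window : 6 ≤ k → parity k ≡ 0ℙ → (i : Fin k) → Window k i
window {suc (suc (suc (suc (suc (suc k)))))} (s≤s (s≤s (s≤s (s≤s (s≤s (s≤s _)))))) k-even i = record
  { a = rotate t a₀ ; b = rotate t b₀ ; c = rotate t c₀ ; d = rotate t d₀
  ; a~b = rotate-preserves-cycAdj t a₀~b₀
  ; b~i = cycAdj-sym (rotate-from-zero i (cycAdj-sym b₀~zero))
  ; i~c = rotate-from-zero i (inj₁ refl)
  ; c~d = rotate-preserves-cycAdj t (inj₁ refl)
  ; b-d = rotate-oddChordPair k-even t (b₀≢d₀ , b₀≁d₀ , b₀+d₀-odd)
  ; c-a = rotate-oddChordPair k-even t (c₀≢a₀ , c₀≁a₀ , c₀+a₀-odd)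
  }
  where
  t = toℕ i
  -- the window around 0, rotated to i
  a₀ b₀ c₀ d₀ : Fin (6 + k)
  a₀ = inject₁ (fromℕ (4 + k))
  b₀ = fromℕ (5 + k)
  c₀ = suc zero
  d₀ = suc (suc zero)
  toℕ-a₀ : toℕ a₀ ≡ 4 + k
  toℕ-a₀ = trans (toℕ-inject₁ (fromℕ (4 + k))) (toℕ-fromℕ (4 + k))
  toℕ-b₀ : toℕ b₀ ≡ 5 + k
  toℕ-b₀ = toℕ-fromℕ (5 + k)
  suc-k-odd : parity (suc k) ≡ 1ℙ
  suc-k-odd = trans (parity-suc k) (cong (1ℙ ℙ.+_) k-even)
  a₀~b₀ : CycAdj (6 + k) a₀ b₀
  a₀~b₀ = inj₁ (trans (cong suc toℕ-a₀) (sym toℕ-b₀))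
  b₀~zero : CycAdj (6 + k) b₀ zero
  b₀~zero = inj₂ (inj₂ (inj₂ (refl , cong suc toℕ-b₀)))
  b₀≢d₀ : b₀ ≢ d₀
  b₀≢d₀ e with () ← trans (sym toℕ-b₀) (cong toℕ e)
  b₀≁d₀ : ¬ CycAdj (6 + k) b₀ d₀
  b₀≁d₀ rewrite toℕ-b₀ = λ
    { (inj₁ ()) ; (inj₂ (inj₁ ())) ; (inj₂ (inj₂ (inj₁ (() , _)))) ; (inj₂ (inj₂ (inj₂ (() , _)))) }
  b₀+d₀-odd : parity (toℕ b₀ + toℕ d₀) ≡ 1ℙ
  b₀+d₀-odd =
    trans (cong (λ x → parity (x + 2)) toℕ-b₀) (trans (cong parity (ℕP.+-comm (5 + k) 2)) suc-k-odd)
  c₀≢a₀ : c₀ ≢ a₀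
  c₀≢a₀ e with () ← trans (cong toℕ e) toℕ-a₀
  c₀≁a₀ : ¬ CycAdj (6 + k) c₀ a₀
  c₀≁a₀ rewrite toℕ-a₀ = λ
    { (inj₁ ()) ; (inj₂ (inj₁ ())) ; (inj₂ (inj₂ (inj₁ (() , _)))) ; (inj₂ (inj₂ (inj₂ (() , _)))) }
  c₀+a₀-odd : parity (toℕ c₀ + toℕ a₀) ≡ 1ℙ
  c₀+a₀-odd = trans (cong (parity ∘ suc) toℕ-a₀) suc-k-odd

-- Induced cycles from signed vertex sequences

does-true : ∀ {P : Set} (P? : Dec P) → does P? ≡ true → P
does-true (yes p) _ = p

adj⇒≢ : ∀ (G : Graph n) {u w} → Adj G u w → u ≢ w
adj⇒≢ G {u} u~w refl with () ← trans (sym u~w) (adj-irrefl G u)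

inducedCycle : {G : Graph n} → 3 ≤ k → (f : Fin k → Fin n) → Injective _≡_ _≡_ f →
  (∀ i j → i ≢ j → adj G (f i) (f j) ≡ does (cycAdj? k i j)) → InducedCycle G k
inducedCycle {k = k} {G = G} 3≤k f f-inj f-edges = 3≤k , f , f-inj , λ i j → edge i j (i FinP.≟ j)
  where
  edge : ∀ i j → Dec (i ≡ j) → (Adj G (f i) (f j) → CycAdj k i j) × (CycAdj k i j → Adj G (f i) (f j))
  edge i j (yes refl) = (λ fi~fi → ⊥-elim (adj⇒≢ G fi~fi refl))
                      , ⊥-elim ∘ cycAdj-irrefl (ℕP.≤-trans (ℕP.m≤m+n 2 1) 3≤k) i
  edge i j (no i≢j)   = (λ fi~fj → does-true (cycAdj? k i j) (trans (sym (f-edges i j i≢j)) fi~fj))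
                      , (λ i~j → trans (f-edges i j i≢j) (dec-true (cycAdj? k i j) i~j))

SignedCycleEdge : Graph n → Vec (Fin n) k → Vec Bool k → Fin k → Fin k → Set
SignedCycleEdge {k = k} G x σ i j =
  lookup x i ≢ lookup x j ×
  adj G (lookup x i) (lookup x j) ≡ does (cycAdj? k i j) xor (lookup σ i xor lookup σ j)

signedCycleEdge-sym : ∀ {G : Graph n} {x : Vec (Fin n) k} {σ} {i j} →
  SignedCycleEdge G x σ i j → SignedCycleEdge G x σ j i
signedCycleEdge-sym {k = k} {G} {x} {σ} {i} {j} (xi≢xj , xi-xj) = xi≢xj ∘ sym , (begin
  adj G (lookup x j) (lookup x i)                        ≡⟨ adj-sym G _ _ ⟩
  adj G (lookup x i) (lookup x j)                        ≡⟨ xi-xj ⟩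
  does (cycAdj? k i j) xor (lookup σ i xor lookup σ j)   ≡⟨ cong₂ _xor_ i~j⇔j~i (xor-comm (lookup σ i) _) ⟩
  does (cycAdj? k j i) xor (lookup σ j xor lookup σ i)   ∎)
  where
  open ≡-Reasoning
  i~j⇔j~i = does-⇔ (mk⇔ cycAdj-sym cycAdj-sym) (cycAdj? k i j) (cycAdj? k j i)

subsetFromSigns : (Fin k → Fin n) → (Fin k → Bool) → VSubset n
subsetFromSigns x σ u with any? (λ i → x i FinP.≟ u)
... | yes (i , _) = σ i
... | no _        = false

subsetFromSigns-at : ∀ {x : Fin k → Fin n} σ → Injective _≡_ _≡_ x →
  ∀ i → subsetFromSigns x σ (x i) ≡ σ i
subsetFromSigns-at {x = x} σ x-inj i with any? (λ j → x j FinP.≟ x i)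
... | yes (j , xj≡xi) = cong σ (x-inj xj≡xi)
... | no ∄j           = ⊥-elim (∄j (i , refl))

switchedInducedCycle : {G : Graph n} → 3 ≤ k → (x : Vec (Fin n) k) (σ : Vec Bool k) →
  AllPairs (SignedCycleEdge G x σ) (allFin k) → ∃ λ A → InducedCycle (S G A) k
switchedInducedCycle {k = k} {G = G} 3≤k x σ edges =
  A , inducedCycle {G = S G A} 3≤k (lookup x) x-inj cycle-edges
  where
  edge : ∀ i j → i ≢ j → SignedCycleEdge G x σ i j
  edge i j i≢j with ∈-AllPairs₂ edges (∈-allFin i) (∈-allFin j)
  ... | inj₁ i≡j        = ⊥-elim (i≢j i≡j)
  ... | inj₂ (inj₁ i-j) = i-j
  ... | inj₂ (inj₂ j-i) = signedCycleEdge-sym {G = G} {x} {σ} {j} {i} j-i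
  x-inj : Injective _≡_ _≡_ (lookup x)
  x-inj {i} {j} xi≡xj with i FinP.≟ j
  ... | yes i≡j = i≡j
  ... | no i≢j  = ⊥-elim (proj₁ (edge i j i≢j) xi≡xj)
  A = subsetFromSigns (lookup x) (lookup σ)
  A-at : ∀ i → A (lookup x i) ≡ lookup σ i
  A-at = subsetFromSigns-at (lookup σ) x-inj
  cycle-edges : ∀ i j → i ≢ j → adj (S G A) (lookup x i) (lookup x j) ≡ does (cycAdj? k i j)
  cycle-edges i j i≢j = begin
    adj (S G A) (lookup x i) (lookup x j)
      ≡⟨ switch-adj G A _ _ ⟩
    adj G (lookup x i) (lookup x j) xor (A (lookup x i) xor A (lookup x j))
      ≡⟨ cong₂ (λ s t → adj G (lookup x i) (lookup x j) xor (s xor t)) (A-at i) (A-at j) ⟩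
    adj G (lookup x i) (lookup x j) xor (lookup σ i xor lookup σ j)
      ≡⟨ cong (_xor _) (proj₂ (edge i j i≢j)) ⟩
    (does (cycAdj? k i j) xor (lookup σ i xor lookup σ j)) xor (lookup σ i xor lookup σ j)
      ≡⟨ xor-cancelʳ _ _ ⟩
    does (cycAdj? k i j)
      ∎
    where open ≡-Reasoning

-- Switches of three cliques

cliqueAdj : Fin 3 × Bool → Fin 3 × Bool → Bool
cliqueAdj (p , s) (q , t) = does (p FinP.≟ q) xor (s xor t)

-- A label (p , s) puts a vertex into clique p; G is the disjoint union of the three cliques,
-- switched at the vertices with s = true.
SwitchOfThreeCliques : GraphClass
SwitchOfThreeCliques {n} G =
  Σ (Fin n → Fin 3 × Bool) λ label → ∀ u w → u ≢ w → adj G u w ≡ cliqueAdj (label u) (label w)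

module IsolatedVertex {n} (H : Graph n) (v : Fin n) (v-isolated : ∀ w → adj H v w ≡ false)
  (noC4 : ∀ A → ¬ InducedCycle (S H A) 4) (noC5 : ∀ A → ¬ InducedCycle (S H A) 5) where

  private
    flip-adj : ∀ {u w b} → adj H u w ≡ b → adj H w u ≡ b
    flip-adj {u} {w} = trans (adj-sym H w u)

    edge⇒≢v : ∀ {u w} → Adj H u w → u ≢ v
    edge⇒≢v {w = w} u~w refl with () ← trans (sym u~w) (v-isolated w)

    distinguished : ∀ {u w z} → Adj H u z → adj H w z ≡ false → u ≢ w
    distinguished u~z w≁z refl with () ← trans (sym u~z) w≁z

  -- Switching at {v , b} makes v a b c an induced 4-cycle.
  noIndependentTriple : ∀ {a b c} → a ≢ v → b ≢ v → c ≢ v → a ≢ b → a ≢ c → b ≢ c →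
    adj H a b ≡ false → adj H a c ≡ false → adj H b c ≡ false → ⊥
  noIndependentTriple {a} {b} {c} a≢v b≢v c≢v a≢b a≢c b≢c a≁b a≁c b≁c =
    uncurry noC4 (switchedInducedCycle {G = H} (ℕP.m≤m+n 3 1)
      (v ∷ a ∷ b ∷ c ∷ []) (true ∷ false ∷ true ∷ false ∷ [])
      ( ((≢-sym a≢v , v-isolated a) ∷ (≢-sym b≢v , v-isolated b) ∷ (≢-sym c≢v , v-isolated c) ∷ [])
      ∷ ((a≢b , a≁b) ∷ (a≢c , a≁c) ∷ [])
      ∷ ((b≢c , b≁c) ∷ [])
      ∷ [] ∷ []))

  noInducedC4 : ∀ {a b c d} → Adj H a b → Adj H b c → Adj H c d → Adj H a d →
    adj H a c ≡ false → adj H b d ≡ false → a ≢ c → b ≢ d → ⊥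
  noInducedC4 {a} {b} {c} {d} a~b b~c c~d a~d a≁c b≁d a≢c b≢d =
    uncurry noC4 (switchedInducedCycle {G = H} (ℕP.m≤m+n 3 1)
      (a ∷ b ∷ c ∷ d ∷ []) (false ∷ false ∷ false ∷ false ∷ [])
      ( ((adj⇒≢ H a~b , a~b) ∷ (a≢c , a≁c) ∷ (adj⇒≢ H a~d , a~d) ∷ [])
      ∷ ((adj⇒≢ H b~c , b~c) ∷ (b≢d , b≁d) ∷ [])
      ∷ ((adj⇒≢ H c~d , c~d) ∷ [])
      ∷ [] ∷ []))

  -- Switching at {a , d} makes v a c b d an induced 5-cycle.
  noInducedP4 : ∀ {a b c d} → Adj H a b → Adj H b c → Adj H c d →
    adj H a c ≡ false → adj H b d ≡ false → adj H a d ≡ false → ⊥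
  noInducedP4 {a} {b} {c} {d} a~b b~c c~d a≁c b≁d a≁d =
    uncurry noC5 (switchedInducedCycle {G = H} (ℕP.m≤m+n 3 2)
      (v ∷ a ∷ c ∷ b ∷ d ∷ []) (false ∷ true ∷ false ∷ false ∷ true ∷ [])
      ( ( (v≢ a~b , v-isolated a) ∷ (v≢ c~d , v-isolated c) ∷ (v≢ b~c , v-isolated b)
        ∷ (v≢ (flip-adj c~d) , v-isolated d) ∷ [])
      ∷ ( (≢-sym (distinguished c~d a≁d) , a≁c) ∷ (adj⇒≢ H a~b , a~b)
        ∷ (≢-sym (distinguished (flip-adj c~d) a≁c) , a≁d) ∷ [])
      ∷ ((≢-sym (adj⇒≢ H b~c) , flip-adj b~c) ∷ (adj⇒≢ H c~d , c~d) ∷ [])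
      ∷ ((distinguished (flip-adj a~b) (flip-adj a≁d) , b≁d) ∷ [])
      ∷ [] ∷ []))
    where
    v≢ : ∀ {u w} → Adj H u w → v ≢ u
    v≢ = ≢-sym ∘ edge⇒≢v

  Universal : Fin n → Set
  Universal u = ∀ w → w ≢ u → w ≢ v → Adj H u w

  universal? : ∀ u → Dec (Universal u)
  universal? u = all? λ w → ¬? (w FinP.≟ u) →-dec (¬? (w FinP.≟ v) →-dec (adj H u w ≟ᵇ true))

  centre-universal : ∀ {a b c} → Adj H a b → Adj H b c → adj H a c ≡ false → a ≢ c → Universal b
  centre-universal {a} {b} {c} a~b b~c a≁c a≢c w w≢b w≢v with adj H b w in b-w
  ... | true  = refl
  ... | false with adj H a w in a-w | adj H c w in c-w
  ...   | false | false = ⊥-elim (noIndependentTriple (edge⇒≢v a~b) (edge⇒≢v (flip-adj b~c)) w≢v a≢c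
                                   (distinguished a~b (flip-adj b-w))
                                   (distinguished (flip-adj b~c) (flip-adj b-w)) a≁c a-w c-w)
  ...   | true  | true  = ⊥-elim (noInducedC4 a~b b~c c-w a-w a≁c b-w a≢c (≢-sym w≢b))
  ...   | true  | false = ⊥-elim (noInducedP4 (flip-adj b~c) (flip-adj a~b) a-w (flip-adj a≁c) b-w c-w)
  ...   | false | true  = ⊥-elim (noInducedP4 a~b b~c c-w a≁c b-w a-w)

  Ordinary : Fin n → Set
  Ordinary u = u ≢ v × ¬ Universal u

  -- The ordinary vertices form two cliques with no edges between them: r with its
  -- neighbours, and the rest.
  module Clusters {r} (r-ordinary : Ordinary r) where

    NearR : Fin n → Set
    NearR u = u ≡ r ⊎ Adj H r u

    near? : ∀ u → Dec (NearR u)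
    near? u = (u FinP.≟ r) ⊎-dec (adj H r u ≟ᵇ true)

    cluster : Fin n → Bool
    cluster u = does (near? u)

    private
      both-near : ∀ {u w} → NearR u → NearR w → u ≢ w → Adj H u w
      both-near (inj₁ refl) (inj₁ refl) u≢w = ⊥-elim (u≢w refl)
      both-near (inj₁ refl) (inj₂ r~w)  _   = r~w
      both-near (inj₂ r~u)  (inj₁ refl) _   = flip-adj r~u
      both-near {u} {w} (inj₂ r~u) (inj₂ r~w) u≢w with adj H u w in u-w
      ... | true  = refl
      ... | false = ⊥-elim (proj₂ r-ordinary (centre-universal (flip-adj r~u) r~w u-w u≢w))

      near-far : ∀ {u w} → NearR u → ¬ NearR w → Ordinary u → adj H u w ≡ false
      near-far (inj₁ refl) w-far _ = ¬-not (w-far ∘ inj₂)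
      near-far {u} {w} (inj₂ r~u) w-far (_ , u-not-universal) with adj H u w in u-w
      ... | false = refl
      ... | true  =
        ⊥-elim (u-not-universal (centre-universal r~u u-w (¬-not (w-far ∘ inj₂)) (w-far ∘ inj₁ ∘ sym)))

      both-far : ∀ {u w} → ¬ NearR u → ¬ NearR w → Ordinary u → Ordinary w → u ≢ w → Adj H u w
      both-far {u} {w} u-far w-far (u≢v , _) (w≢v , _) u≢w with adj H u w in u-w
      ... | true  = refl
      ... | false = ⊥-elim (noIndependentTriple (proj₁ r-ordinary) u≢v w≢v
                                     (u-far ∘ inj₁ ∘ sym) (w-far ∘ inj₁ ∘ sym) u≢w
                                     (¬-not (u-far ∘ inj₂)) (¬-not (w-far ∘ inj₂)) u-w)

    cluster-adj : ∀ {u w} → Ordinary u → Ordinary w → u ≢ w → adj H u w ≡ does (cluster u ≟ᵇ cluster w)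
    cluster-adj {u} {w} u-ord w-ord u≢w = by-cases (near? u) (near? w)
      where
      by-cases : (u? : Dec (NearR u)) (w? : Dec (NearR w)) → adj H u w ≡ does (does u? ≟ᵇ does w?)
      by-cases (yes u-near) (yes w-near) = both-near u-near w-near u≢w
      by-cases (yes u-near) (no w-far)   = near-far u-near w-far u-ord
      by-cases (no u-far)   (yes w-near) = flip-adj (near-far w-near u-far w-ord)
      by-cases (no u-far)   (no w-far)   = both-far u-far w-far u-ord w-ord u≢w

  data Kind (u : Fin n) : Set where
    isolated  : u ≡ v → Kind u
    universal : u ≢ v → Universal u → Kind u
    ordinary  : Ordinary u → Kind u

  kind : ∀ u → Kind u
  kind u with u FinP.≟ v | universal? u
  ... | yes u≡v | _     = isolated u≡v
  ... | no u≢v  | yes U = universal u≢v U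
  ... | no u≢v  | no ¬U = ordinary (u≢v , ¬U)

  private
    clique : Bool → Fin 3
    clique b = suc (if b then zero else suc zero)

    clique-≟ : ∀ b c → does (clique b FinP.≟ clique c) xor false ≡ does (b ≟ᵇ c)
    clique-≟ true  true  = refl
    clique-≟ true  false = refl
    clique-≟ false true  = refl
    clique-≟ false false = refl

  module Labelling (cluster : Fin n → Bool)
    (cluster-adj : ∀ {u w} → Ordinary u → Ordinary w → u ≢ w → adj H u w ≡ does (cluster u ≟ᵇ cluster w))
    where

    label : ∀ {u} → Kind u → Fin 3 × Bool
    label (isolated _)    = zero , false
    label (universal _ _) = zero , true
    label {u} (ordinary _) = clique (cluster u) , false

    label-adj : ∀ {u w} (ku : Kind u) (kw : Kind w) → u ≢ w → adj H u w ≡ cliqueAdj (label ku) (label kw)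
    label-adj (isolated refl)        (isolated refl)         u≢w = ⊥-elim (u≢w refl)
    label-adj (isolated refl)        (universal _ _)         _   = v-isolated _
    label-adj (isolated refl)        (ordinary _)            _   = v-isolated _
    label-adj (universal _ _)        (isolated refl)         _   = flip-adj (v-isolated _)
    label-adj (ordinary _)           (isolated refl)         _   = flip-adj (v-isolated _)
    label-adj (universal _ u-univ)   (universal w≢v _)       u≢w = u-univ _ (≢-sym u≢w) w≢v
    label-adj (universal _ u-univ)   (ordinary (w≢v , _))    u≢w = u-univ _ (≢-sym u≢w) w≢v
    label-adj (ordinary (u≢v , _))   (universal _ w-univ)    u≢w = flip-adj (w-univ _ u≢w u≢v)
    label-adj {u} {w} (ordinary u-ord) (ordinary w-ord)     u≢w =
      trans (cluster-adj u-ord w-ord u≢w) (sym (clique-≟ (cluster u) (cluster w)))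

    labelling : SwitchOfThreeCliques H
    labelling = (λ u → label (kind u)) , λ u w → label-adj (kind u) (kind w)

  threeCliques : SwitchOfThreeCliques H
  threeCliques with any? (λ r → ¬? (r FinP.≟ v) ×-dec ¬? (universal? r))
  ... | yes (_ , r-ord) = Labelling.labelling (Clusters.cluster r-ord) (Clusters.cluster-adj r-ord)
  ... | no ∄ordinary    = Labelling.labelling (λ _ → true) (λ u-ord → ⊥-elim (∄ordinary (_ , u-ord)))

threeCliques-resp : Respects≈ SwitchOfThreeCliques
threeCliques-resp G≈H (label , label-adj) =
  label , λ u w u≢w → trans (sym (adj-≡ G≈H u w)) (label-adj u w u≢w)

threeCliques-switch : {G : Graph n} → SwitchOfThreeCliques G → ∀ A → SwitchOfThreeCliques (S G A)
threeCliques-switch {G = G} (label , label-adj) A = switched , λ u w u≢w → begin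
  adj (S G A) u w                                       ≡⟨ switch-adj G A u w ⟩
  adj G u w xor (A u xor A w)                           ≡⟨ cong (_xor (A u xor A w)) (label-adj u w u≢w) ⟩
  (same u w xor (side u xor side w)) xor (A u xor A w)  ≡⟨ xor-regroup (same u w) (side u) (side w) (A u) (A w) ⟩
  cliqueAdj (switched u) (switched w)                   ∎
  where
  open ≡-Reasoning
  clique : _ → Fin 3
  clique = proj₁ ∘ label
  side : _ → Bool
  side = proj₂ ∘ label
  same : _ → _ → Bool
  same u w = does (clique u FinP.≟ clique w)
  switched : _ → Fin 3 × Bool
  switched u = clique u , side u xor A u

lowerC456Free⇒threeCliques : {G : Graph n} → Lower C456Free G → SwitchOfThreeCliques G
lowerC456Free⇒threeCliques {zero}  _ = (λ ()) , λ ()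
lowerC456Free⇒threeCliques {suc n} {G} lower =
  threeCliques-resp (switch-involutive G N) (threeCliques-switch {G = S G N} H-cliques N)
  where
  N = adj G zero
  H-lower : Lower C456Free (S G N)
  H-lower = lower-switch c456Free-resp {G = G} lower N
  H-cliques : SwitchOfThreeCliques (S G N)
  H-cliques = IsolatedVertex.threeCliques (S G N) zero (switch-isolates G zero)
                (proj₁ ∘ H-lower) (proj₁ ∘ proj₂ ∘ H-lower)

-- Blow-ups of a path

near : Fin 6 → Fin 6 → Bool
near p q = (toℕ p ℕ.≤ᵇ suc (toℕ q)) ∧ (toℕ q ℕ.≤ᵇ suc (toℕ p))

PathBlowUp : GraphClass
PathBlowUp {n} G = Σ (Fin n → Fin 6) λ pos → ∀ u w → u ≢ w → adj G u w ≡ near (pos u) (pos w)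

all-Bool? : {P : Bool → Set} → (∀ b → Dec (P b)) → Dec (∀ b → P b)
all-Bool? P? =
  map′ (λ (t , f) → λ { true → t ; false → f }) (λ ∀P → ∀P true , ∀P false) (P? true ×-dec P? false)

-- The six labels around a hexagon, so that labels are adjacent exactly when they are equal or
-- consecutive.
hexagon : Fin 3 × Bool → Fin 6
hexagon (zero , false)             = zero
hexagon (suc zero , true)          = suc zero
hexagon (suc (suc zero) , false)   = suc (suc zero)
hexagon (zero , true)              = suc (suc (suc zero))
hexagon (suc zero , false)         = suc (suc (suc (suc zero)))
hexagon (suc (suc zero) , true)    = suc (suc (suc (suc (suc zero))))

hexAdj : Fin 6 → Fin 6 → Bool
hexAdj g h = does (g FinP.≟ h) ∨ does (cycAdj? 6 g h)

cliqueAdj-hexagon : ∀ l m → cliqueAdj l m ≡ hexAdj (hexagon l) (hexagon m)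
cliqueAdj-hexagon (p , s) (q , t) = from-yes
  (all? λ p → all-Bool? λ s → all? λ q → all-Bool? λ t →
    cliqueAdj (p , s) (q , t) ≟ᵇ hexAdj (hexagon (p , s)) (hexagon (q , t))) p s q t

-- Rotates the hexagon so that e comes last; the other five labels then lie on the path
-- 0 - 1 - 2 - 3 - 4.
unroll : Fin 6 → Fin 6 → Fin 6
unroll e = rotate (toℕ (opposite e))

hexAdj-unroll : ∀ e g h → g ≢ e → h ≢ e → hexAdj g h ≡ near (unroll e g) (unroll e h)
hexAdj-unroll = from-yes (all? λ e → all? λ g → all? λ h → ¬? (g FinP.≟ e) →-dec (¬? (h FinP.≟ e) →-dec
  (hexAdj g h ≟ᵇ near (unroll e g) (unroll e h))))

-- Representatives of all six labels would span an induced 6-cycle.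
threeCliques⇒pathBlowUp : {G : Graph n} → SwitchOfThreeCliques G → ¬ InducedCycle G 6 → PathBlowUp G
threeCliques⇒pathBlowUp {n} {G} (label , label-adj) noC6
  with all? (λ e → any? (λ u → hexagon (label u) FinP.≟ e))
... | yes every-position =
  ⊥-elim (noC6 (inducedCycle {G = G} (ℕP.m≤m+n 3 3) rep rep-injective rep-edges))
  where
  rep : Fin 6 → Fin n
  rep e = proj₁ (every-position e)
  rep-at : ∀ e → hexagon (label (rep e)) ≡ e
  rep-at e = proj₂ (every-position e)
  rep-injective : Injective _≡_ _≡_ rep
  rep-injective {e} {e′} eq = trans (sym (rep-at e)) (trans (cong (hexagon ∘ label) eq) (rep-at e′))
  rep-edges : ∀ e e′ → e ≢ e′ → adj G (rep e) (rep e′) ≡ does (cycAdj? 6 e e′)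
  rep-edges e e′ e≢e′ = begin
    adj G (rep e) (rep e′)
      ≡⟨ label-adj _ _ (e≢e′ ∘ rep-injective) ⟩
    cliqueAdj (label (rep e)) (label (rep e′))
      ≡⟨ cliqueAdj-hexagon (label (rep e)) (label (rep e′)) ⟩
    hexAdj (hexagon (label (rep e))) (hexagon (label (rep e′)))
      ≡⟨ cong₂ hexAdj (rep-at e) (rep-at e′) ⟩
    does (e FinP.≟ e′) ∨ does (cycAdj? 6 e e′)
      ≡⟨ cong (_∨ does (cycAdj? 6 e e′)) (dec-false (e FinP.≟ e′) e≢e′) ⟩
    does (cycAdj? 6 e e′)
      ∎
    where open ≡-Reasoning
... | no missing-position with ¬∀⟶∃¬ 6 _ (λ e → any? (λ u → hexagon (label u) FinP.≟ e)) missing-position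
...   | e , e-unused = (λ u → unroll e (hexagon (label u))) , λ u w u≢w →
  trans (label-adj u w u≢w) (trans (cliqueAdj-hexagon (label u) (label w))
    (hexAdj-unroll e (hexagon (label u)) (hexagon (label w)) (e-unused ∘ (u ,_)) (e-unused ∘ (w ,_))))

lowerC456Free⇒pathBlowUp : {G : Graph n} → Lower C456Free G → ∀ A → PathBlowUp (S G A)
lowerC456Free⇒pathBlowUp {G = G} lower A =
  threeCliques⇒pathBlowUp {G = S G A}
    (threeCliques-switch {G = G} (lowerC456Free⇒threeCliques {G = G} lower) A)
    (proj₂ (proj₂ (lower A)))

-- Interval graphs are chordal

infix 4 _⊆_
_⊆_ : GraphClass → GraphClass → Set
𝒢 ⊆ ℋ = ∀ {n} (G : Graph n) → 𝒢 G → ℋ G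

module _ {a ℓ₁ ℓ₂} (O : TotalOrder a ℓ₁ ℓ₂) where
  open TotalOrder O using (Carrier) renaming (_≤_ to _≼_)
  open Extrema O using (argmin; argmax; f[argmin]≤f[xs]; f[xs]≤f[argmax])

  argmin-Fin : (h : Fin (suc k) → Carrier) → ∃ λ i → ∀ j → h i ≼ h j
  argmin-Fin h =
    argmin h zero (allFin _) , λ j → All.lookup (f[argmin]≤f[xs] zero (allFin _)) (∈-allFin j)

  argmax-Fin : (h : Fin (suc k) → Carrier) → ∃ λ i → ∀ j → h j ≼ h i
  argmax-Fin h =
    argmax h zero (allFin _) , λ j → All.lookup (f[xs]≤f[argmax] zero (allFin _)) (∈-allFin j)

-- The interval of i ends first, so the intervals of both cycle neighbours of i contain its
-- right end and meet.
interval⇒chordal : Interval-graph ⊆ Chordal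
interval⇒chordal G (ι , model) (suc k) 4≤k (_ , f , f-inj , f-cycle) =
  let i , i-ends-first = argmin-Fin (DecTotalOrder.totalOrder ℚP.≤-decTotalOrder) (r ∘ ι ∘ f)
      a , b , i~a , i~b , a≢b , a≁b = neighbours 4≤k i
  in a≁b (proj₁ (f-cycle a b) (proj₂ (model (f a) (f b) (a≢b ∘ f-inj))
       ( ℚP.≤-trans (proj₂ (meets i~a)) (i-ends-first b)
       , ℚP.≤-trans (proj₂ (meets i~b)) (i-ends-first a))))
  where
  meets : ∀ {x y} → CycAdj (suc k) x y → Intersect (ι (f x)) (ι (f y))
  meets x~y =
    proj₁ (model _ _ (cycAdj⇒≢ (ℕP.≤-trans (ℕP.m≤m+n 2 2) 4≤k) x~y ∘ f-inj)) (proj₂ (f-cycle _ _) x~y)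

properInterval⇒interval : ProperInterval ⊆ Interval-graph
properInterval⇒interval _ (ι , model , _) = ι , model

chordal⇒C456Free : Chordal ⊆ C456Free
chordal⇒C456Free _ chordal = chordal 4 ℕP.≤-refl , chordal 5 (ℕP.n≤1+n 4) , chordal 6 (ℕP.m≤n+m 4 2)

-- Blow-ups of a path are proper interval, strongly chordal and Ptolemaic

endpoint : ℕ → ℚ
endpoint m = + m / 1

unitInterval : Fin 6 → Interval
unitInterval p = [ endpoint (toℕ p) , endpoint (suc (toℕ p)) ]⟨ increasing p ⟩
  where
  increasing : ∀ p → endpoint (toℕ p) ≤ℚ endpoint (suc (toℕ p))
  increasing = from-yes (all? λ (p : Fin 6) → endpoint (toℕ p) ℚP.≤? endpoint (suc (toℕ p)))

intersect? : ∀ I J → Dec (Intersect I J)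
intersect? I J = (l I ℚP.≤? r J) ×-dec (l J ℚP.≤? r I)

properlyContained? : ∀ I J → Dec (ProperlyContained I J)
properlyContained? I J =
  (l J ℚP.≤? l I) ×-dec (r I ℚP.≤? r J) ×-dec ((l J ℚP.<? l I) ⊎-dec (r I ℚP.<? r J))

near-unitInterval : ∀ p q → near p q ≡ does (intersect? (unitInterval p) (unitInterval q))
near-unitInterval = from-yes (all? λ (p : Fin 6) → all? λ (q : Fin 6) →
  near p q ≟ᵇ does (intersect? (unitInterval p) (unitInterval q)))

unitInterval-proper : ∀ p q → ¬ ProperlyContained (unitInterval p) (unitInterval q)
unitInterval-proper = from-yes (all? λ (p : Fin 6) → all? λ (q : Fin 6) →
  ¬? (properlyContained? (unitInterval p) (unitInterval q)))

pathBlowUp⇒properInterval : PathBlowUp ⊆ ProperInterval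
pathBlowUp⇒properInterval G (pos , pos-adj) =
  unitInterval ∘ pos , model , λ u w → unitInterval-proper (pos u) (pos w)
  where
  model : IsIntervalModel G (unitInterval ∘ pos)
  model u w u≢w =
      (λ u~w → does-true meet? (trans (sym adj≡meet) u~w))
    , (λ meet → trans adj≡meet (dec-true meet? meet))
    where
    meet? = intersect? (unitInterval (pos u)) (unitInterval (pos w))
    adj≡meet : adj G u w ≡ does meet?
    adj≡meet = trans (pos-adj u w u≢w) (near-unitInterval (pos u) (pos w))

pathBlowUp⇒chordal : PathBlowUp ⊆ Chordal
pathBlowUp⇒chordal G = interval⇒chordal G ∘ properInterval⇒interval G ∘ pathBlowUp⇒properInterval G

near-window-at-max : ∀ a b m c d → a ≤ᶠ m → b ≤ᶠ m → c ≤ᶠ m → d ≤ᶠ m →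
  near a b ≡ true → near b m ≡ true → near m c ≡ true → near c d ≡ true →
  near b d ≡ true ⊎ near c a ≡ true
near-window-at-max = from-yes
  (all? λ a → all? λ b → all? λ m → all? λ c → all? λ d →
    (a FinP.≤? m) →-dec (b FinP.≤? m) →-dec (c FinP.≤? m) →-dec (d FinP.≤? m) →-dec
    (near a b ≟ᵇ true) →-dec (near b m ≟ᵇ true) →-dec (near m c ≟ᵇ true) →-dec (near c d ≟ᵇ true) →-dec
    ((near b d ≟ᵇ true) ⊎-dec (near c a ≟ᵇ true)))

-- Around a cycle vertex m of highest position, one of the chords b d and c a of the window
-- a b m c d is present.
pathBlowUp-oddChord : {G : Graph n} → PathBlowUp G → ∀ k → 6 ≤ k → k % 2 ≡ 0 →
  (f : Fin k → Fin n) → CycleIn G k f → HasOddChord G k f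
pathBlowUp-oddChord {G = G} (pos , pos-adj) (suc k) 6≤k k-even f (_ , f-inj , f-cycle) =
  let m , m-highest = argmax-Fin (FinP.≤-totalOrder 6) (pos ∘ f)
      open Window (window 6≤k (%2≡0⇒parity≡0ℙ (suc k) k-even) m)
  in [ oddChord b-d , oddChord c-a ]′
       (near-window-at-max (pos (f a)) (pos (f b)) (pos (f m)) (pos (f c)) (pos (f d))
          (m-highest a) (m-highest b) (m-highest c) (m-highest d)
          (near-along a~b) (near-along b~i) (near-along i~c) (near-along c~d))
  where
  near-along : ∀ {x y} → CycAdj (suc k) x y → near (pos (f x)) (pos (f y)) ≡ true
  near-along x~y =
    trans (sym (pos-adj _ _ (cycAdj⇒≢ (ℕP.≤-trans (ℕP.m≤m+n 2 4) 6≤k) x~y ∘ f-inj))) (f-cycle _ _ x~y)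
  oddChord : ∀ {x y} → OddChordPair (suc k) x y → near (pos (f x)) (pos (f y)) ≡ true →
    HasOddChord G (suc k) f
  oddChord {x} {y} (x≢y , x≁y , odd) near-xy =
    x , y , trans (pos-adj _ _ (x≢y ∘ f-inj)) near-xy , x≁y , parity≡1ℙ⇒%2≡1 (toℕ x + toℕ y) odd

pathBlowUp⇒stronglyChordal : PathBlowUp ⊆ StronglyChordal
pathBlowUp⇒stronglyChordal G blowUp = pathBlowUp⇒chordal G blowUp , pathBlowUp-oddChord {G = G} blowUp

gemAdj? : ∀ i j → Dec (GemAdj i j)
gemAdj? i j =
  ((suc (toℕ i) ℕ.≟ toℕ j) ×-dec (toℕ j ℕ.≤? 3)) ⊎-dec
  ((suc (toℕ j) ℕ.≟ toℕ i) ×-dec (toℕ i ℕ.≤? 3)) ⊎-dec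
  (((toℕ i ℕ.≟ 4) ×-dec (toℕ j ℕ.≤? 3)) ⊎-dec ((toℕ j ℕ.≟ 4) ×-dec (toℕ i ℕ.≤? 3)))

-- The ends of an induced P4 lie three positions apart, too far for a common neighbour.
no-gem-positions : ∀ a b c d e → near a b ≡ true → near b c ≡ true → near c d ≡ true →
  near a c ≡ false → near b d ≡ false → near a d ≡ false → near e a ≡ true → near e d ≡ false
no-gem-positions = from-yes
  (all? λ a → all? λ b → all? λ c → all? λ d → all? λ e →
    (near a b ≟ᵇ true) →-dec (near b c ≟ᵇ true) →-dec (near c d ≟ᵇ true) →-dec
    (near a c ≟ᵇ false) →-dec (near b d ≟ᵇ false) →-dec (near a d ≟ᵇ false) →-dec
    (near e a ≟ᵇ true) →-dec (near e d ≟ᵇ false))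

pathBlowUp⇒gemFree : {G : Graph n} → PathBlowUp G → ¬ InducedGem G
pathBlowUp⇒gemFree {G = G} (pos , pos-adj) (f , f-inj , f-gem) =
  not-¬ (near-gem (# 4) (# 3) (λ ()))
              (no-gem-positions (p (# 0)) (p (# 1)) (p (# 2)) (p (# 3)) (p (# 4))
                (near-gem (# 0) (# 1) (λ ())) (near-gem (# 1) (# 2) (λ ())) (near-gem (# 2) (# 3) (λ ()))
                (near-gem (# 0) (# 2) (λ ())) (near-gem (# 1) (# 3) (λ ())) (near-gem (# 0) (# 3) (λ ()))
                (near-gem (# 4) (# 0) (λ ())))
  where
  p : Fin 5 → Fin 6
  p = pos ∘ f
  near-gem : ∀ i j → i ≢ j → near (p i) (p j) ≡ does (gemAdj? i j)
  near-gem i j i≢j = trans (sym (pos-adj (f i) (f j) (i≢j ∘ f-inj))) (by-cases (gemAdj? i j))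
    where
    by-cases : (i~j? : Dec (GemAdj i j)) → adj G (f i) (f j) ≡ does i~j?
    by-cases (yes i~j) = proj₂ (f-gem i j) i~j
    by-cases (no i≁j)  = ¬-not (i≁j ∘ proj₁ (f-gem i j))

pathBlowUp⇒ptolemaic : PathBlowUp ⊆ Ptolemaic
pathBlowUp⇒ptolemaic G blowUp = pathBlowUp⇒chordal G blowUp , pathBlowUp⇒gemFree {G = G} blowUp

-- The lower switching classes

lower-≐-C456Free : {𝒢 : GraphClass} → 𝒢 ⊆ Chordal → PathBlowUp ⊆ 𝒢 → Lower 𝒢 ≐ Lower C456Free
lower-≐-C456Free 𝒢⊆chordal blowUp⊆𝒢 G =
    (λ lower A → chordal⇒C456Free (S G A) (𝒢⊆chordal (S G A) (lower A)))
  , (λ lower A → blowUp⊆𝒢 (S G A) (lowerC456Free⇒pathBlowUp {G = G} lower A))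

mainTheorem13 :
    (Lower Chordal ≐ Lower C456Free) ×
    (Lower StronglyChordal ≐ Lower C456Free) ×
    (Lower Interval-graph ≐ Lower C456Free) ×
    (Lower ProperInterval ≐ Lower C456Free) ×
    (Lower Ptolemaic ≐ Lower C456Free)
mainTheorem13 =
    lower-≐-C456Free (λ _ → id) pathBlowUp⇒chordal
  , lower-≐-C456Free (λ _ → proj₁) pathBlowUp⇒stronglyChordal
  , lower-≐-C456Free interval⇒chordal (λ G → properInterval⇒interval G ∘ pathBlowUp⇒properInterval G)
  , lower-≐-C456Free (λ G → interval⇒chordal G ∘ properInterval⇒interval G) pathBlowUp⇒properInterval
  , lower-≐-C456Free (λ _ → proj₁) pathBlowUp⇒ptolemaic
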